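{- Let $G=(V\cup\{m\},E)$ be a $k$-prn-irreducible comparability graph and $G'=(V'\cup\{m'\},E')$ a $k'$-prn-irreducible comparability graph, with disjoint vertex sets. Then $G\ast G'$ is a comparability graph if and only if $m$ is a source of $G$ and $m'$ is a sink of $G'$ with respect to some transitive orientations of $G$ and $G'$.
   Context: All graphs are finite, simple and connected. A comparability graph is a graph admitting a transitive orientation ($\overrightarrow{ab},\overrightarrow{bc}$ imply $\overrightarrow{ac}$); a source (sink) is a vertex of in-degree (out-degree) zero. Comparability graphs are exactly the graphs represented by a concatenation of permutations of their vertex set (a word represents a graph if distinct vertices are adjacent iff their occurrences alternate); $\mathcal{R}^p(C)$ is the least number of permutations needed. For $k\ge 2$, a comparability graph $C=(W,F)$ is $k$-prn-irreducible if $\mathcal{R}^p(C)=k$ and $\mathcal{R}^p(C[W\setminus\{a\}])=k-1$ for every $a\in W$. Split recomposition: $G\ast G'$ has vertex set $V\cup V'$ and edges: those of $G[V]$, those of $G'[V']$, and all $\overline{ab}$ with $a\in N_G(m)$, $b\in N_{G'}(m')$. -}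

module Defs where

open import Level using (Level; _⊔_) renaming (suc to lsuc; zero to lzero)
open import Data.Nat using (ℕ; zero; suc; _≤_; _∸_)
open import Data.Fin using (Fin; punchIn; _≟_)
open import Data.Sum using (_⊎_; inj₁; inj₂)
open import Data.Product using (_×_; Σ; ∃; ∃-syntax; _,_)
open import Data.Empty using (⊥)
open import Data.List using (List; []; _∷_; filter; concat; length; allFin)
open import Data.List.Relation.Unary.All using (All)
open import Data.List.Relation.Unary.Linked using (Linked)
open import Data.List.Relation.Binary.Permutation.Propositional using (_↭_)
open import Relation.Nullary using (¬_)
open import Relation.Nullary.Decidable using (_⊎-dec_)
open import Relation.Binary.PropositionalEquality using (_≡_; _≢_)
open import Relation.Binary.Construct.Closure.ReflexiveTransitive using (Star)

record Graph (n : ℕ) : Set₁ where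
  field
    Adj    : Fin n → Fin n → Set
    sym    : ∀ {x y} → Adj x y → Adj y x
    irrefl : ∀ {x} → ¬ Adj x x
open Graph public

Connected : ∀ {n} → Graph n → Set
Connected G = ∀ x y → Star (Adj G) x y

delete : ∀ {n} → Graph (suc n) → Fin (suc n) → Graph n
delete G a = record
  { Adj    = λ x y → Adj G (punchIn a x) (punchIn a y)
  ; sym    = sym G
  ; irrefl = irrefl G
  }

record IsTransitiveOrientation {A : Set} (E : A → A → Set) (O : A → A → Set) : Set where
  field
    sub     : ∀ {a b} → O a b → E a b
    total   : ∀ {a b} → E a b → O a b ⊎ O b a
    asym    : ∀ {a b} → O a b → ¬ O b a
    trans   : ∀ {a b c} → O a b → O b c → O a c

IsComparability : {A : Set} → (A → A → Set) → Set₁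
IsComparability {A} E = Σ (A → A → Set) (IsTransitiveOrientation E)

Source : {A : Set} → (A → A → Set) → A → Set
Source O m = ∀ x → ¬ O x m

Sink : {A : Set} → (A → A → Set) → A → Set
Sink O m = ∀ x → ¬ O m x

restrict : ∀ {n} → Fin n → Fin n → List (Fin n) → List (Fin n)
restrict x y = filter (λ z → (z ≟ x) ⊎-dec (z ≟ y))

Alternate : ∀ {n} → Fin n → Fin n → List (Fin n) → Set
Alternate x y w = Linked _≢_ (restrict x y w)

Represents : ∀ {n} → List (Fin n) → Graph n → Set
Represents {n} w G =
  ∀ (x y : Fin n) → x ≢ y → (Adj G x y → Alternate x y w) × (Alternate x y w → Adj G x y)

RepByPerms : ∀ {n} → Graph n → ℕ → Set
RepByPerms {n} G k =
  ∃[ ps ] (length ps ≡ k × All (_↭ allFin n) ps × Represents (concat ps) G)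

Rp≡ : ∀ {n} → Graph n → ℕ → Set
Rp≡ G k = 1 ≤ k × RepByPerms G k × (∀ j → 1 ≤ j → RepByPerms G j → k ≤ j)

PrnIrreducible : ∀ {n} → ℕ → Graph (suc n) → Set₁
PrnIrreducible k G =
  2 ≤ k × IsComparability (Adj G) × Rp≡ G k × (∀ a → Rp≡ (delete G a) (k ∸ 1))

-- Split recomposition G ∗ G' with G on V ∪ {m}, G' on V' ∪ {m'}.
-- V is Fin n (embedded by punchIn m), V' is Fin n'; vertex set V ⊎ V'.

SplitAdj : ∀ {n n'} → Graph (suc n) → Fin (suc n) → Graph (suc n') → Fin (suc n')
         → Fin n ⊎ Fin n' → Fin n ⊎ Fin n' → Set
SplitAdj G m G' m' (inj₁ a) (inj₁ b) = Adj G (punchIn m a) (punchIn m b)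
SplitAdj G m G' m' (inj₂ a) (inj₂ b) = Adj G' (punchIn m' a) (punchIn m' b)
SplitAdj G m G' m' (inj₁ a) (inj₂ b) = Adj G m (punchIn m a) × Adj G' m' (punchIn m' b)
SplitAdj G m G' m' (inj₂ b) (inj₁ a) = Adj G m (punchIn m a) × Adj G' m' (punchIn m' b)

-- If m is a source and m' a sink, keep both orientations and direct every new edge from N(m') to N(m);
-- a path through a new edge then passes m → N(m) in G or N(m') → m' in G', where transitivity holds.
-- Conversely a transitive orientation T of G ∗ G' restricts to G - m. When N(m) is up-closed (resp.
-- down-closed) in it, m can be added to it (resp. to its reverse) as a source. Otherwise some a ∈ N(m) has
-- an out-neighbour outside N(m) and some a' ∈ N(m) an in-neighbour outside N(m); transitivity forces
-- a → b → a' for every b ∈ N(m'), so N(m') ∪ {m'} is closed under adjacency in G' and, G' being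
-- connected, m' is adjacent to all of G'. But a universal vertex can be put in front of each permutation
-- representing G' - m', so ℛᵖ(G') ≤ ℛᵖ(G' - m'), against irreducibility. Exchanging G and G' gives the sink.
module Submission where

open import Defs
open import Data.Bool using (true; false)
open import Data.Nat using (ℕ; zero; suc; s≤s)
open import Data.Nat.Properties using (1+n≰n)
open import Data.Fin using (Fin; zero; suc; punchIn; punchOut; _≟_)
open import Data.Fin.Properties using (punchIn-punchOut; punchInᵢ≢i; punchIn-injective; any?)
open import Data.Product using (_×_; ∃-syntax; _,_; proj₁; proj₂)
open import Data.Sum as Sum using (_⊎_; inj₁; inj₂)
open import Data.Empty using (⊥-elim)
open import Data.List using (List; []; _∷_; [_]; _++_; map; filter; concat; replicate; length; allFin)
open import Data.List.Properties using (filter-++; filter-accept; filter-reject; filter-none; filter-≐; map-++; map-∘; map-tabulate; length-map)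
open import Data.List.Relation.Unary.All as All using (All; []; _∷_)
import Data.List.Relation.Unary.All.Properties as Allₚ
open import Data.List.Relation.Unary.Any using (here; there)
open import Data.List.Membership.Propositional using (_∈_)
open import Data.List.Membership.Propositional.Properties using (∈-allFin)
open import Data.List.Relation.Unary.Unique.Propositional using (Unique)
open import Data.List.Relation.Unary.AllPairs using (_∷_)
open import Data.List.Relation.Unary.Unique.Propositional.Properties using (allFin⁺)
open import Data.List.Relation.Unary.Linked as Linked using (Linked; []; [-]; _∷_; linked?)
import Data.List.Relation.Unary.Linked.Properties as Linkedₚ
open import Data.List.Relation.Binary.Permutation.Propositional using (_↭_; ↭-refl; ↭-reflexive; ↭-prep; ↭-swap; ↭-trans; module PermutationReasoning)
open import Data.List.Relation.Binary.Permutation.Propositional.Properties using (filter-↭; ↭-singleton-inv) renaming (map⁺ to ↭-map⁺)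
open import Function using (_∘_; flip; _on_; id; const)
open import Function.Definitions using (Injective)
open import Function.Bundles using (_⇔_; mk⇔; Equivalence)
open import Relation.Nullary using (¬_; Dec; yes; no; does; ¬?; _×-dec_)
open import Relation.Unary using (_≐_) renaming (Decidable to Decidable₁)
open import Relation.Nullary.Decidable using (_⊎-dec_; map′; decidable-stable)
open import Relation.Binary.Definitions using (Symmetric; Decidable; DecidableEquality; _Respects_)
open import Relation.Binary.PropositionalEquality using (_≡_; _≢_; refl; cong; cong₂; subst; module ≡-Reasoning)
  renaming (sym to ≡-sym; trans to ≡-trans)
open import Relation.Binary.Construct.Closure.ReflexiveTransitive using (fold)

module _ {A : Set} {E O : A → A → Set} (O-to : IsTransitiveOrientation E O) where
  open IsTransitiveOrientation O-to

  reverse : Symmetric E → IsTransitiveOrientation E (flip O)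
  reverse E-sym = record
    { sub   = λ o → E-sym (sub o)
    ; total = λ e → Sum.swap (total e)
    ; asym  = asym
    ; trans = λ o o' → trans o' o
    }

  orientation? : Decidable E → Decidable O
  orientation? E? a b with E? a b
  ... | no ¬e = no (λ o → ¬e (sub o))
  ... | yes e with total e
  ...   | inj₁ o = yes o
  ...   | inj₂ o = no (asym o)

  source-out : ∀ {s x} → Source O s → E s x → O s x
  source-out src e with total e
  ... | inj₁ o = o
  ... | inj₂ o = ⊥-elim (src _ o)

Neighbour : ∀ {n} → Graph (suc n) → Fin (suc n) → Fin n → Set
Neighbour G m a = Adj G m (punchIn m a)

Universal : ∀ {n} → Graph (suc n) → Fin (suc n) → Set
Universal G m = ∀ a → Neighbour G m a

pivot-or-punchIn : ∀ {n} (m u : Fin (suc n)) → u ≡ m ⊎ ∃[ a ] u ≡ punchIn m a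
pivot-or-punchIn m u with m ≟ u
... | yes m≡u = inj₁ (≡-sym m≡u)
... | no m≢u  = inj₂ (punchOut m≢u , ≡-sym (punchIn-punchOut m≢u))

connected-respects : ∀ {n} {G : Graph n} {P : Fin n → Set} → Connected G → P Respects Adj G
                   → ∀ {x} → P x → ∀ y → P y
connected-respects {P = P} conn resp {x} px y =
  fold (λ u v → P u → P v) (λ e k → k ∘ resp e) id (conn x y) px

module _ {n} (G : Graph (suc n)) (m : Fin (suc n)) {R : Fin n → Fin n → Set}
         (R-to : IsTransitiveOrientation (Adj (delete G m)) R)
         (up : Neighbour G m Respects R) where
  private module R = IsTransitiveOrientation R-to

  data ConeOrientation (u v : Fin (suc n)) : Set where
    apex  : u ≡ m → Adj G m v → ConeOrientation u v
    inner : ∀ {a b} → u ≡ punchIn m a → v ≡ punchIn m b → R a b → ConeOrientation u v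

  private
    cone-sub : ∀ {u v} → ConeOrientation u v → Adj G u v
    cone-sub (apex refl e)       = e
    cone-sub (inner refl refl r) = R.sub r

    cone-total : ∀ {u v} → Adj G u v → ConeOrientation u v ⊎ ConeOrientation v u
    cone-total {u} {v} e with pivot-or-punchIn m u | pivot-or-punchIn m v
    ... | inj₁ refl       | _               = inj₁ (apex refl e)
    ... | inj₂ _          | inj₁ refl       = inj₂ (apex refl (sym G e))
    ... | inj₂ (a , refl) | inj₂ (b , refl) = Sum.map (inner refl refl) (inner refl refl) (R.total e)

    cone-asym : ∀ {u v} → ConeOrientation u v → ¬ ConeOrientation v u
    cone-asym (apex refl e)       (apex refl _)       = irrefl G e
    cone-asym (apex u≡m _)        (inner _ u≡a _)     = punchInᵢ≢i m _ (≡-trans (≡-sym u≡a) u≡m)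
    cone-asym (inner _ v≡b _)     (apex v≡m _)        = punchInᵢ≢i m _ (≡-trans (≡-sym v≡b) v≡m)
    cone-asym (inner refl refl r) (inner b≡b' a≡a' r')
      with refl ← punchIn-injective m _ _ b≡b' | refl ← punchIn-injective m _ _ a≡a' = R.asym r r'

    cone-trans : ∀ {u v w} → ConeOrientation u v → ConeOrientation v w → ConeOrientation u w
    cone-trans (apex refl e)       (apex refl _)       = ⊥-elim (irrefl G e)
    cone-trans (apex refl e)       (inner refl refl r) = apex refl (up r e)
    cone-trans (inner _ v≡b _)     (apex v≡m _)        = ⊥-elim (punchInᵢ≢i m _ (≡-trans (≡-sym v≡b) v≡m))
    cone-trans (inner refl refl r) (inner b≡b' refl r')
      with refl ← punchIn-injective m _ _ b≡b' = inner refl refl (R.trans r r')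

    cone-source : Source ConeOrientation m
    cone-source _ (apex _ e)        = irrefl G e
    cone-source _ (inner _ m≡b _)   = punchInᵢ≢i m _ (≡-sym m≡b)

  cone-extension : ∃[ O ] IsTransitiveOrientation (Adj G) O × Source O m
  cone-extension = ConeOrientation
                 , record { sub = cone-sub ; total = cone-total ; asym = cone-asym ; trans = cone-trans }
                 , cone-source

SourceSinkOrientable : ∀ {n n'} → Graph (suc n) → Fin (suc n) → Graph (suc n') → Fin (suc n') → Set₁
SourceSinkOrientable G m G' m' =
  ∃[ O ] ∃[ O' ] (IsTransitiveOrientation (Adj G) O × IsTransitiveOrientation (Adj G') O'
                   × Source O m × Sink O' m')

module _ {n n'} {G : Graph (suc n)} {m : Fin (suc n)} {G' : Graph (suc n')} {m' : Fin (suc n')} where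

  SplitAdj-sym : Symmetric (SplitAdj G m G' m')
  SplitAdj-sym {inj₁ _} {inj₁ _} e = sym G e
  SplitAdj-sym {inj₂ _} {inj₂ _} e = sym G' e
  SplitAdj-sym {inj₁ _} {inj₂ _} e = e
  SplitAdj-sym {inj₂ _} {inj₁ _} e = e

  SplitAdj-swap : ∀ {u v} → SplitAdj G' m' G m u v → SplitAdj G m G' m' (Sum.swap u) (Sum.swap v)
  SplitAdj-swap {inj₁ _} {inj₁ _} e        = e
  SplitAdj-swap {inj₂ _} {inj₂ _} e        = e
  SplitAdj-swap {inj₁ _} {inj₂ _} (e , e') = e' , e
  SplitAdj-swap {inj₂ _} {inj₁ _} (e , e') = e' , e

  SplitAdj-unswap : ∀ {u v} → SplitAdj G m G' m' (Sum.swap u) (Sum.swap v) → SplitAdj G' m' G m u v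
  SplitAdj-unswap {inj₁ _} {inj₁ _} e        = e
  SplitAdj-unswap {inj₂ _} {inj₂ _} e        = e
  SplitAdj-unswap {inj₁ _} {inj₂ _} (e , e') = e' , e
  SplitAdj-unswap {inj₂ _} {inj₁ _} (e , e') = e' , e

  swap-orientation : ∀ {T} → IsTransitiveOrientation (SplitAdj G m G' m') T
                   → IsTransitiveOrientation (SplitAdj G' m' G m) (T on Sum.swap)
  swap-orientation T-to = record
    { sub   = λ {u} {v} t → SplitAdj-unswap {u} {v} (sub t)
    ; total = λ {u} {v} e → total (SplitAdj-swap {u} {v} e)
    ; asym  = asym
    ; trans = trans
    }
    where open IsTransitiveOrientation T-to

  module _ {O O'} (O-to : IsTransitiveOrientation (Adj G) O) (O'-to : IsTransitiveOrientation (Adj G') O')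
           (src : Source O m) (snk : Sink O' m') where
    private
      module O  = IsTransitiveOrientation O-to
      module O' = IsTransitiveOrientation O'-to

    data SourceSinkOrientation : Fin n ⊎ Fin n' → Fin n ⊎ Fin n' → Set where
      left  : ∀ {a b} → O (punchIn m a) (punchIn m b) → SourceSinkOrientation (inj₁ a) (inj₁ b)
      right : ∀ {a b} → O' (punchIn m' a) (punchIn m' b) → SourceSinkOrientation (inj₂ a) (inj₂ b)
      cross : ∀ {a b} → Neighbour G m a → Neighbour G' m' b → SourceSinkOrientation (inj₂ b) (inj₁ a)

    private
      out-of-m : ∀ {x} → Adj G m x → O m x
      out-of-m = source-out O-to src

      into-m' : ∀ {x} → Adj G' m' x → O' x m'
      into-m' = source-out (reverse O'-to (sym G')) snk

      split-sub : ∀ {u v} → SourceSinkOrientation u v → SplitAdj G m G' m' u v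
      split-sub (left o)    = O.sub o
      split-sub (right o)   = O'.sub o
      split-sub (cross a b) = a , b

      split-total : ∀ {u v} → SplitAdj G m G' m' u v
                  → SourceSinkOrientation u v ⊎ SourceSinkOrientation v u
      split-total {inj₁ _} {inj₁ _} e       = Sum.map left left (O.total e)
      split-total {inj₂ _} {inj₂ _} e       = Sum.map right right (O'.total e)
      split-total {inj₁ _} {inj₂ _} (a , b) = inj₂ (cross a b)
      split-total {inj₂ _} {inj₁ _} (a , b) = inj₁ (cross a b)

      split-asym : ∀ {u v} → SourceSinkOrientation u v → ¬ SourceSinkOrientation v u
      split-asym (left o)  (left o')  = O.asym o o'
      split-asym (right o) (right o') = O'.asym o o'

      split-trans : ∀ {u v w} → SourceSinkOrientation u v → SourceSinkOrientation v w
                  → SourceSinkOrientation u w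
      split-trans (left o)    (left o')   = left (O.trans o o')
      split-trans (right o)   (right o')  = right (O'.trans o o')
      split-trans (cross a b) (left o)    = cross (O.sub (O.trans (out-of-m a) o)) b
      split-trans (right o)   (cross a b) = cross a (sym G' (O'.sub (O'.trans o (into-m' b))))

    source-sink-orientation : IsTransitiveOrientation (SplitAdj G m G' m') SourceSinkOrientation
    source-sink-orientation = record
      { sub = split-sub ; total = split-total ; asym = split-asym ; trans = split-trans }

source-sink⇒comparability : ∀ {n n'} (G : Graph (suc n)) (m : Fin (suc n))
                            (G' : Graph (suc n')) (m' : Fin (suc n'))
                          → SourceSinkOrientable G m G' m' → IsComparability (SplitAdj G m G' m')
source-sink⇒comparability G m G' m' (_ , _ , O-to , O'-to , source , sink) =
  _ , source-sink-orientation O-to O'-to source sink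

module _ {n n'} {G : Graph (suc n)} {m : Fin (suc n)} {G' : Graph (suc n')} {m' : Fin (suc n')}
         {T : Fin n ⊎ Fin n' → Fin n ⊎ Fin n' → Set}
         (T-to : IsTransitiveOrientation (SplitAdj G m G' m') T) where
  open IsTransitiveOrientation T-to

  Left : Fin n → Fin n → Set
  Left a b = T (inj₁ a) (inj₁ b)

  left-orientation : IsTransitiveOrientation (Adj (delete G m)) Left
  left-orientation = record
    { sub   = sub
    ; total = total
    ; asym  = asym
    ; trans = trans
    }

  -- Otherwise b → a → x, and the edge b x of the split would put x into N(m).
  precedes-right-neighbours : ∀ {a x} → Neighbour G m a → ¬ Neighbour G m x → Left a x
                            → ∀ {b} → Neighbour G' m' b → T (inj₁ a) (inj₂ b)
  precedes-right-neighbours {a} {x} na ¬nx ax {b} nb with total {inj₁ a} {inj₂ b} (na , nb)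
  ... | inj₁ ab = ab
  ... | inj₂ ba = ⊥-elim (¬nx (proj₁ (sub {inj₂ b} {inj₁ x} (trans ba ax))))

  module _ {a a'}
           (a-precedes : ∀ {b} → Neighbour G' m' b → T (inj₁ a) (inj₂ b))
           (a'-succeeds : ∀ {b} → Neighbour G' m' b → T (inj₂ b) (inj₁ a')) where

    private
      ClosedNeighbour : Fin (suc n') → Set
      ClosedNeighbour y = y ≡ m' ⊎ Adj G' m' y

      -- Whichever way an edge z w with z ∈ N(m') is oriented, a → z → w or w → z → a' puts w into N(m').
      closed-neighbour-respects : ClosedNeighbour Respects Adj G'
      closed-neighbour-respects e (inj₁ refl) = inj₂ e
      closed-neighbour-respects {z} {w} e (inj₂ m'z) with pivot-or-punchIn m' z | pivot-or-punchIn m' w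
      ... | inj₁ refl        | _               = ⊥-elim (irrefl G' m'z)
      ... | _                | inj₁ w≡m'       = inj₁ w≡m'
      ... | inj₂ (z₀ , refl) | inj₂ (w₀ , refl) =
        inj₂ (Sum.[ via-a , via-a' ]′ (total {inj₂ z₀} {inj₂ w₀} e))
        where
        via-a : T (inj₂ z₀) (inj₂ w₀) → Neighbour G' m' w₀
        via-a zw = proj₂ (sub {inj₁ a} {inj₂ w₀} (trans (a-precedes m'z) zw))
        via-a' : T (inj₂ w₀) (inj₂ z₀) → Neighbour G' m' w₀
        via-a' wz = proj₂ (sub {inj₂ w₀} {inj₁ a'} (trans wz (a'-succeeds m'z)))

    right-universal : Connected G' → Universal G' m'
    right-universal conn' b
      with connected-respects {G = G'} {P = ClosedNeighbour} conn' closed-neighbour-respects (inj₁ refl)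
                              (punchIn m' b)
    ... | inj₁ b≡m' = ⊥-elim (punchInᵢ≢i m' b b≡m')
    ... | inj₂ m'b  = m'b

module _ {n n'} {G : Graph (suc n)} {m : Fin (suc n)} {G' : Graph (suc n')} {m' : Fin (suc n')}
         {T : Fin n ⊎ Fin n' → Fin n ⊎ Fin n' → Set}
         (T-to : IsTransitiveOrientation (SplitAdj G m G' m') T)
         (G? : Decidable (Adj G)) (conn' : Connected G') (¬universal : ¬ Universal G' m') where

  private
    N? : ∀ a → Dec (Neighbour G m a)
    N? a = G? m (punchIn m a)

    Left? : Decidable (Left T-to)
    Left? = orientation? (left-orientation T-to) (λ a b → G? (punchIn m a) (punchIn m b))

    reversed : IsTransitiveOrientation (SplitAdj G m G' m') (flip T)
    reversed = reverse T-to λ {u} {v} → SplitAdj-sym {G = G} {m = m} {G' = G'} {m' = m'} {u} {v}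

  neighbourhood-closed : Neighbour G m Respects Left T-to ⊎ Neighbour G m Respects flip (Left T-to)
  neighbourhood-closed with any? (λ a → any? (λ x → N? a ×-dec ¬? (N? x) ×-dec Left? a x))
  ... | no ¬escape = inj₁ λ {a} {x} ax na →
    decidable-stable (N? x) λ ¬nx → ¬escape (a , x , na , ¬nx , ax)
  ... | yes (a , x , na , ¬nx , ax) = inj₂ λ {a'} {x'} x'a' na' →
    decidable-stable (N? x') λ ¬nx' → ¬universal (right-universal T-to
      (precedes-right-neighbours T-to na ¬nx ax)
      (precedes-right-neighbours reversed na' ¬nx' x'a')
      conn')

  split-source : ∃[ O ] IsTransitiveOrientation (Adj G) O × Source O m
  split-source with neighbourhood-closed
  ... | inj₁ up   = cone-extension G m (left-orientation T-to) up
  ... | inj₂ down = cone-extension G m (reverse (left-orientation T-to) (sym (delete G m))) down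

comparability⇒source-sink : ∀ {n n'} (G : Graph (suc n)) (m : Fin (suc n))
                            (G' : Graph (suc n')) (m' : Fin (suc n'))
                          → Decidable (Adj G) → Decidable (Adj G') → Connected G → Connected G'
                          → ¬ Universal G m → ¬ Universal G' m'
                          → IsComparability (SplitAdj G m G' m') → SourceSinkOrientable G m G' m'
comparability⇒source-sink G m G' m' G? G'? conn conn' ¬universal ¬universal' (T , T-to)
  with O , O-to , source ← split-source T-to G? conn' ¬universal'
     | O' , O'-to , source' ← split-source (swap-orientation T-to) G'? conn ¬universal
  = O , flip O' , O-to , reverse O'-to (sym G') , source , source'

filter-map : ∀ {A B : Set} {P : B → Set} (P? : Decidable₁ P) (f : A → B) xs
           → filter P? (map f xs) ≡ map f (filter (P? ∘ f) xs)
filter-map P? f [] = refl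
filter-map P? f (x ∷ xs) with does (P? (f x))
... | true  = cong (f x ∷_) (filter-map P? f xs)
... | false = filter-map P? f xs

module _ {A : Set} (_≟ₐ_ : DecidableEquality A) where

  filter-≟-unique : ∀ {x xs} → Unique xs → x ∈ xs → filter (_≟ₐ x) xs ≡ [ x ]
  filter-≟-unique (x≢xs ∷ _) (here refl) =
    ≡-trans (filter-accept (_≟ₐ _) refl)
            (cong (_ ∷_) (filter-none (_≟ₐ _) (All.map (λ x≢z z≡x → x≢z (≡-sym z≡x)) x≢xs)))
  filter-≟-unique (z≢xs ∷ xs!) (there x∈xs) =
    ≡-trans (filter-reject (_≟ₐ _) (All.lookup z≢xs x∈xs)) (filter-≟-unique xs! x∈xs)

linked-≢-map : ∀ {A B : Set} {f : A → B} → Injective _≡_ _≡_ f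
             → ∀ {xs} → Linked _≢_ (map f xs) ⇔ Linked _≢_ xs
linked-≢-map {f = f} f-injective = mk⇔
  (λ fxs → Linked.map (λ fx≢fy x≡y → fx≢fy (cong f x≡y)) (Linkedₚ.map⁻ fxs))
  (λ xs → Linkedₚ.map⁺ (Linked.map (λ x≢y fx≡fy → x≢y (f-injective fx≡fy)) xs))

replicate-alternates : ∀ {A : Set} {x y : A} → x ≢ y → ∀ k → Linked _≢_ (concat (replicate k (x ∷ y ∷ [])))
replicate-alternates x≢y 0             = []
replicate-alternates x≢y 1             = x≢y ∷ [-]
replicate-alternates x≢y (suc (suc k)) = x≢y ∷ (x≢y ∘ ≡-sym) ∷ replicate-alternates x≢y (suc k)

alternate-sym : ∀ {n} {x y : Fin n} w → Alternate x y w → Alternate y x w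
alternate-sym w = subst (Linked _≢_) (filter-≐ _ _ (Sum.swap , Sum.swap) w)

conePerm : ∀ {n} → Fin (suc n) → List (Fin n) → List (Fin (suc n))
conePerm m p = m ∷ map (punchIn m) p

allFin-suc : ∀ n → allFin (suc n) ≡ zero ∷ map suc (allFin n)
allFin-suc n = cong (zero ∷_) (≡-sym (map-tabulate id suc))

conePerm-allFin : ∀ {n} (m : Fin (suc n)) → conePerm m (allFin n) ↭ allFin (suc n)
conePerm-allFin {n}     zero    = ↭-reflexive (≡-sym (allFin-suc n))
conePerm-allFin {suc n} (suc m) = begin
    suc m ∷ map (punchIn (suc m)) (allFin (suc n))
  ≡⟨ cong (λ l → suc m ∷ map (punchIn (suc m)) l) (allFin-suc n) ⟩
    suc m ∷ zero ∷ map (punchIn (suc m)) (map suc (allFin n))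
  ≡⟨ cong (λ l → suc m ∷ zero ∷ l) (≡-trans (≡-sym (map-∘ (allFin n))) (map-∘ (allFin n))) ⟩
    suc m ∷ zero ∷ map suc (map (punchIn m) (allFin n))
  ↭⟨ ↭-swap (suc m) zero ↭-refl ⟩
    zero ∷ map suc (conePerm m (allFin n))
  ↭⟨ ↭-prep zero (↭-map⁺ suc (conePerm-allFin m)) ⟩
    zero ∷ map suc (allFin (suc n))
  ≡⟨ allFin-suc (suc n) ⟨
    allFin (suc (suc n)) ∎
  where open PermutationReasoning

conePerm-↭ : ∀ {n} (m : Fin (suc n)) {p} → p ↭ allFin n → conePerm m p ↭ allFin (suc n)
conePerm-↭ m p↭ = ↭-trans (↭-prep m (↭-map⁺ (punchIn m) p↭)) (conePerm-allFin m)

module _ {n} (m : Fin (suc n)) where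

  coneWord : List (List (Fin n)) → List (Fin (suc n))
  coneWord ps = concat (map (conePerm m) ps)

  private
    punchIn-≐ : ∀ x y → (λ z → punchIn m z ≡ punchIn m x ⊎ punchIn m z ≡ punchIn m y)
                      ≐ (λ z → z ≡ x ⊎ z ≡ y)
    punchIn-≐ x y = Sum.map (punchIn-injective m _ _) (punchIn-injective m _ _)
                  , Sum.map (cong (punchIn m)) (cong (punchIn m))

    pivot-≐ : ∀ y → (λ z → punchIn m z ≡ m ⊎ punchIn m z ≡ punchIn m y) ≐ (_≡ y)
    pivot-≐ y = Sum.[ (λ pz≡m → ⊥-elim (punchInᵢ≢i m _ pz≡m)) , punchIn-injective m _ _ ]′
              , inj₂ ∘ cong (punchIn m)

  restrict-conePerm : ∀ x y p → restrict (punchIn m x) (punchIn m y) (conePerm m p)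
                              ≡ map (punchIn m) (restrict x y p)
  restrict-conePerm x y p = begin
      restrict (punchIn m x) (punchIn m y) (conePerm m p)
    ≡⟨ filter-reject Q? Sum.[ punchInᵢ≢i m x ∘ ≡-sym , punchInᵢ≢i m y ∘ ≡-sym ]′ ⟩
      filter Q? (map (punchIn m) p)
    ≡⟨ filter-map Q? (punchIn m) p ⟩
      map (punchIn m) (filter (Q? ∘ punchIn m) p)
    ≡⟨ cong (map (punchIn m)) (filter-≐ (Q? ∘ punchIn m) _ (punchIn-≐ x y) p) ⟩
      map (punchIn m) (restrict x y p) ∎
    where
    open ≡-Reasoning
    Q? : Decidable₁ (λ z → z ≡ punchIn m x ⊎ z ≡ punchIn m y)
    Q? z = (z ≟ punchIn m x) ⊎-dec (z ≟ punchIn m y)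

  restrict-conePerm-pivot : ∀ y {p} → p ↭ allFin n
                          → restrict m (punchIn m y) (conePerm m p) ≡ m ∷ punchIn m y ∷ []
  restrict-conePerm-pivot y {p} p↭ = begin
      restrict m (punchIn m y) (conePerm m p)
    ≡⟨ filter-accept Q? (inj₁ refl) ⟩
      m ∷ filter Q? (map (punchIn m) p)
    ≡⟨ cong (m ∷_) (filter-map Q? (punchIn m) p) ⟩
      m ∷ map (punchIn m) (filter (Q? ∘ punchIn m) p)
    ≡⟨ cong (λ l → m ∷ map (punchIn m) l) (filter-≐ (Q? ∘ punchIn m) (_≟ y) (pivot-≐ y) p) ⟩
      m ∷ map (punchIn m) (filter (_≟ y) p)
    ≡⟨ cong (λ l → m ∷ map (punchIn m) l) (↭-singleton-inv only-y) ⟩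
      m ∷ punchIn m y ∷ [] ∎
    where
    open ≡-Reasoning
    Q? : Decidable₁ (λ z → z ≡ m ⊎ z ≡ punchIn m y)
    Q? z = (z ≟ m) ⊎-dec (z ≟ punchIn m y)
    only-y : filter (_≟ y) p ↭ [ y ]
    only-y = ↭-trans (filter-↭ (_≟ y) p↭) (↭-reflexive (filter-≟-unique _≟_ (allFin⁺ n) (∈-allFin y)))

  restrict-coneWord : ∀ x y ps → restrict (punchIn m x) (punchIn m y) (coneWord ps)
                               ≡ map (punchIn m) (restrict x y (concat ps))
  restrict-coneWord x y []       = refl
  restrict-coneWord x y (p ∷ ps) = begin
      restrict (punchIn m x) (punchIn m y) (conePerm m p ++ coneWord ps)
    ≡⟨ filter-++ _ (conePerm m p) (coneWord ps) ⟩
      restrict (punchIn m x) (punchIn m y) (conePerm m p)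
        ++ restrict (punchIn m x) (punchIn m y) (coneWord ps)
    ≡⟨ cong₂ _++_ (restrict-conePerm x y p) (restrict-coneWord x y ps) ⟩
      map (punchIn m) (restrict x y p) ++ map (punchIn m) (restrict x y (concat ps))
    ≡⟨ map-++ (punchIn m) (restrict x y p) _ ⟨
      map (punchIn m) (restrict x y p ++ restrict x y (concat ps))
    ≡⟨ cong (map (punchIn m)) (filter-++ _ p (concat ps)) ⟨
      map (punchIn m) (restrict x y (p ++ concat ps)) ∎
    where open ≡-Reasoning

  restrict-coneWord-pivot : ∀ y {ps} → All (_↭ allFin n) ps
                          → restrict m (punchIn m y) (coneWord ps)
                            ≡ concat (replicate (length ps) (m ∷ punchIn m y ∷ []))
  restrict-coneWord-pivot y []                   = refl
  restrict-coneWord-pivot y {p ∷ ps} (p↭ ∷ ps↭) =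
    ≡-trans (filter-++ _ (conePerm m p) (coneWord ps))
            (cong₂ _++_ (restrict-conePerm-pivot y p↭) (restrict-coneWord-pivot y ps↭))

  alternate-coneWord : ∀ x y ps
                     → Alternate (punchIn m x) (punchIn m y) (coneWord ps) ⇔ Alternate x y (concat ps)
  alternate-coneWord x y ps =
    subst (λ l → Linked _≢_ l ⇔ Alternate x y (concat ps)) (≡-sym (restrict-coneWord x y ps))
          (linked-≢-map (punchIn-injective m _ _))

  alternate-coneWord-pivot : ∀ y {ps} → All (_↭ allFin n) ps → Alternate m (punchIn m y) (coneWord ps)
  alternate-coneWord-pivot y {ps} ps↭ =
    subst (Linked _≢_) (≡-sym (restrict-coneWord-pivot y ps↭))
          (replicate-alternates (punchInᵢ≢i m y ∘ ≡-sym) (length ps))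

cone-RepByPerms : ∀ {n j} {G : Graph (suc n)} {m} → Universal G m → RepByPerms (delete G m) j → RepByPerms G j
cone-RepByPerms {G = G} {m} universal (ps , length≡j , ps↭ , represents) =
  map (conePerm m) ps
  , ≡-trans (length-map (conePerm m) ps) length≡j
  , Allₚ.map⁺ (All.map (conePerm-↭ m) ps↭)
  , cone-represents
  where
  cone-represents : Represents (coneWord m ps) G
  cone-represents x y x≢y with pivot-or-punchIn m x | pivot-or-punchIn m y
  ... | inj₁ refl       | inj₁ refl       = ⊥-elim (x≢y refl)
  ... | inj₁ refl       | inj₂ (b , refl) =
    const (alternate-coneWord-pivot m b ps↭) , const (universal b)
  ... | inj₂ (a , refl) | inj₁ refl       =
    const (alternate-sym (coneWord m ps) (alternate-coneWord-pivot m a ps↭)) , const (sym G (universal a))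
  ... | inj₂ (a , refl) | inj₂ (b , refl) = from ∘ adj⇒alt , alt⇒adj ∘ to
    where
    open Equivalence (alternate-coneWord m a b ps)
    adj⇒alt : Adj (delete G m) a b → Alternate a b (concat ps)
    adj⇒alt = proj₁ (represents a b (x≢y ∘ cong (punchIn m)))
    alt⇒adj : Alternate a b (concat ps) → Adj (delete G m) a b
    alt⇒adj = proj₂ (represents a b (x≢y ∘ cong (punchIn m)))

represented-adj? : ∀ {n} {w : List (Fin n)} (G : Graph n) → Represents w G → Decidable (Adj G)
represented-adj? {w = w} G represents x y with x ≟ y
... | yes refl = no (irrefl G)
... | no x≢y   = map′ (proj₂ (represents x y x≢y)) (proj₁ (represents x y x≢y))
                      (linked? (λ a b → ¬? (a ≟ b)) (restrict x y w))

irreducible-adj? : ∀ {n k} (G : Graph (suc n)) → PrnIrreducible k G → Decidable (Adj G)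
irreducible-adj? G (_ , _ , (_ , (ps , _ , _ , represents) , _) , _) =
  represented-adj? {w = concat ps} G represents

-- A universal vertex could be put in front of every permutation representing G - m, so ℛᵖ(G) ≤ ℛᵖ(G - m) = k - 1.
irreducible-¬universal : ∀ {n k} (G : Graph (suc n)) → PrnIrreducible k G → ∀ m → ¬ Universal G m
irreducible-¬universal G (s≤s _ , _ , (_ , _ , minimal) , deleted-Rp) m universal
  with 1≤k-1 , represents , _ ← deleted-Rp m =
  1+n≰n (minimal _ 1≤k-1 (cone-RepByPerms {G = G} universal represents))

corollary7 : ∀ {n n' k k' : ℕ} (G : Graph (suc n)) (m : Fin (suc n))
               (G' : Graph (suc n')) (m' : Fin (suc n'))
               → Connected G → Connected G'
               → PrnIrreducible k G → PrnIrreducible k' G'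
               → (IsComparability (SplitAdj G m G' m')
                  ⇔ (∃[ O ] ∃[ O' ] (IsTransitiveOrientation (Adj G) O
                       × IsTransitiveOrientation (Adj G') O'
                       × Source O m × Sink O' m')))
corollary7 G m G' m' conn conn' irr irr' =
  mk⇔ (comparability⇒source-sink G m G' m' (irreducible-adj? G irr) (irreducible-adj? G' irr') conn conn'
                                 (irreducible-¬universal G irr m) (irreducible-¬universal G' irr' m'))
      (source-sink⇒comparability G m G' m')
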